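{- Let $h\ge1$ and $k\ge 0$ be integers, and write $\gamma_i=\gamma_i(h)$ for the elements of the greedy $B_h$-set. For $1\le r\le h$ define \[F_r^{(k)}:=\left\{\frac1r\sum_{i=1}^k\gamma_i(m_i-m_i') : m_i,m_i'\in\mathbb N=\{0,1,2,\dots\},\ \sum_{i=1}^k m_i\le h,\ \sum_{i=1}^k m_i'\le h-r\right\},\] and $F^{(k)}:=\bigcup_{r=1}^h F_r^{(k)}$. Then \[\gamma_{k+1}=\operatorname{mex} F^{(k)},\] where $\operatorname{mex} S$ denotes the smallest nonnegative integer not belonging to $S$.
   Context: A set $\mathcal A$ of nonnegative integers is a $B_h$-set if every solution of $a_1+\dots+a_h=b_1+\dots+b_h$ with $a_i,b_i\in\mathcal A$ has $\{a_1,\dots,a_h\}=\{b_1,\dots,b_h\}$ as multisets. The greedy $B_h$-set $\{\gamma_0,\gamma_1,\gamma_2,\dots\}$ is defined by $\gamma_0=0$ and, for $k\ge0$, $\gamma_{k+1}$ is the smallest integer $x>\gamma_k$ such that $\{\gamma_0,\dots,\gamma_k,x\}$ is a $B_h$-set (so $\gamma_1=1$). Note that $\gamma_0$ does not appear in the sums defining $F_r^{(k)}$ and the multiplicity sums are only bounded above, not required to equal $h$ or $h-r$. -}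

module Defs where

open import Data.Nat using (ℕ; zero; suc; _+_; _*_; _∸_; _≤_; _<_)
open import Data.Integer as ℤ using (ℤ; +_)
open import Data.Rational using (ℚ; _/_)
open import Data.Vec using (Vec; toList; sum)
open import Data.Vec.Relation.Unary.All using (All)
open import Data.List.Relation.Binary.Permutation.Propositional using (_↭_)
open import Data.Product using (Σ; ∃; ∃-syntax; _×_)
open import Data.Sum using (_⊎_)
open import Relation.Binary.PropositionalEquality using (_≡_)
open import Relation.Nullary using (¬_)

sumℕ : ℕ → (ℕ → ℕ) → ℕ
sumℕ zero    f = 0
sumℕ (suc k) f = sumℕ k f + f (suc k)

sumℤ : ℕ → (ℕ → ℤ) → ℤ
sumℤ zero    f = + 0
sumℤ (suc k) f = sumℤ k f ℤ.+ f (suc k)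

IsBh : ℕ → (ℕ → Set) → Set
IsBh h A = (a b : Vec ℕ h) → All A a → All A b →
           sum a ≡ sum b → toList a ↭ toList b

Extend : (ℕ → ℕ) → ℕ → ℕ → ℕ → Set
Extend γ k x y = (∃[ i ] (i ≤ k × y ≡ γ i)) ⊎ y ≡ x

IsGreedyBh : ℕ → (ℕ → ℕ) → Set
IsGreedyBh h γ =
  γ 0 ≡ 0 ×
  (∀ k → γ k < γ (suc k) × IsBh h (Extend γ k (γ (suc k))) ×
         (∀ x → γ k < x → x < γ (suc k) → ¬ IsBh h (Extend γ k x)))

-- q ∈ F_r^{(k)} with r = suc r':
-- q = (1/r) Σ_{i=1}^k γ_i (m_i − m_i'),  Σ m_i ≤ h,  Σ m_i' ≤ h − r.
InF_r : ℕ → (ℕ → ℕ) → ℕ → ℕ → ℚ → Set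
InF_r h γ k r' q =
  ∃[ m ] ∃[ m' ] (sumℕ k m ≤ h × sumℕ k m' ≤ h ∸ suc r' ×
    q ≡ sumℤ k (λ i → + γ i ℤ.* (+ m i ℤ.- + m' i)) / suc r')

InF : ℕ → (ℕ → ℕ) → ℕ → ℚ → Set
InF h γ k q = ∃[ r' ] (suc r' ≤ h × InF_r h γ k r' q)

IsMex : (ℚ → Set) → ℕ → Set
IsMex S n = ¬ S (+ n / 1) × (∀ j → j < n → S (+ j / 1))

-- Write x = γ (k + 1) and j for a candidate below it.
-- An identity r·x = Σ γᵢ (mᵢ − mᵢ') with Σ mᵢ ≤ h and Σ mᵢ' ≤ h − r is a
-- pair of equal h-term sums over {γ₀, …, γₖ, x} (pad with γ₀ = 0) in which x
-- occurs only on one side; so x ∉ F⁽ᵏ⁾ because {γ₀, …, γₖ, x} is a Bₕ-set.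
-- Conversely, if j ∉ F⁽ᵏ⁾ then {γ₀, …, γₖ, j} is a Bₕ-set: in an equality of
-- two h-term sums, different numbers of copies of j on the two sides would
-- put j in F⁽ᵏ⁾, and equal numbers cancel, leaving an equality inside the
-- Bₕ-set {γ₀, …, γₖ}. By greediness every j with γₖ < j < x is therefore in
-- F⁽ᵏ⁾; j = γₖ is in it trivially, and j < γₖ by induction since F⁽ᵏ⁻¹⁾ ⊆ F⁽ᵏ⁾.
-- Constructively this needs F⁽ᵏ⁾ to be decidable, which holds because its
-- definition only quantifies over finitely many multiplicity vectors.

{-# OPTIONS --safe #-}
module Submission where

open import Defs
open import Data.Empty using (⊥-elim)
open import Data.Integer as ℤ using (ℤ; +_)
import Data.Integer.Properties as ℤ
open import Data.Integer.Tactic.RingSolver as ℤ-Solver using ()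
open import Data.List using (List; []; _∷_; length; _++_; replicate)
open import Data.List.Membership.Propositional using (_∈_)
open import Data.List.Membership.Propositional.Properties using (∈-++⁺ʳ)
open import Data.List.Properties using (length-++; length-replicate)
open import Data.List.Relation.Binary.Permutation.Propositional
  using (_↭_; prep; ↭-refl; ↭-sym; ↭-trans; ↭-reflexive)
open import Data.List.Relation.Binary.Permutation.Propositional.Properties
  using (↭-length; shift; drop-∷; ++⁺ˡ; ∈-resp-↭)
open import Data.List.Relation.Unary.All as All using (All; []; _∷_)
open import Data.List.Relation.Unary.All.Properties using (++⁺; replicate⁺)
open import Data.List.Relation.Unary.Any using (here)
open import Data.Nat using (ℕ; zero; suc; _+_; _*_; _∸_; _≤_; _<_; z≤n; s≤s; _≟_)
open import Data.Nat.ListAction using (sum)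
open import Data.Nat.ListAction.Properties using (sum-++; sum-↭)
open import Data.Nat.Properties
open import Algebra.Properties.CommutativeSemigroup +-commutativeSemigroup using (interchange)
open import Data.Nat.Tactic.RingSolver as ℕ-Solver using ()
open import Data.Product using (∃; ∃₂; _×_; _,_; proj₁; proj₂)
open import Data.Rational as ℚ using (_/_)
open import Data.Rational.Properties using (fromℚᵘ-injective; fromℚᵘ-cong)
open import Data.Rational.Unnormalised using (mkℚᵘ; *≡*)
open import Data.Sum using (_⊎_; inj₁; inj₂)
open import Data.Vec as Vec using (Vec; toList; fromList)
open import Data.Vec.Properties using (toList∘fromList; length-toList)
import Data.Vec.Relation.Unary.All as VecAll
open import Data.Vec.Relation.Unary.All.Properties using (toList⁺; toList⁻)
open import Function using (_∘_)
open import Relation.Binary.Definitions using (Tri; tri<; tri≈; tri>)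
open import Relation.Binary.PropositionalEquality
open import Relation.Nullary using (¬_; Dec; yes; no; contradiction)
open import Relation.Nullary.Decidable using (map′; decidable-stable)
open import Relation.Unary using (Decidable)

_≗[_]_ : {A : Set} → (ℕ → A) → ℕ → (ℕ → A) → Set
f ≗[ k ] g = ∀ {i} → 1 ≤ i → i ≤ k → f i ≡ g i

≗-pred : ∀ {A : Set} {f g : ℕ → A} {k} → f ≗[ suc k ] g → f ≗[ k ] g
≗-pred f≗g 1≤i i≤k = f≗g 1≤i (m≤n⇒m≤1+n i≤k)

sumℕ-cong : ∀ k {f g} → f ≗[ k ] g → sumℕ k f ≡ sumℕ k g
sumℕ-cong zero    f≗g = refl
sumℕ-cong (suc k) f≗g = cong₂ _+_ (sumℕ-cong k (≗-pred f≗g)) (f≗g (s≤s z≤n) ≤-refl)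

sumℤ-cong : ∀ k {f g} → f ≗[ k ] g → sumℤ k f ≡ sumℤ k g
sumℤ-cong zero    f≗g = refl
sumℤ-cong (suc k) f≗g = cong₂ ℤ._+_ (sumℤ-cong k (≗-pred f≗g)) (f≗g (s≤s z≤n) ≤-refl)

sumℕ-+ : ∀ k f g → sumℕ k (λ i → f i + g i) ≡ sumℕ k f + sumℕ k g
sumℕ-+ zero    f g = refl
sumℕ-+ (suc k) f g =
  trans (cong (_+ (f (suc k) + g (suc k))) (sumℕ-+ k f g))
        (interchange (sumℕ k f) (sumℕ k g) (f (suc k)) (g (suc k)))

sumℕ-zero : ∀ k → sumℕ k (λ _ → 0) ≡ 0
sumℕ-zero zero    = refl
sumℕ-zero (suc k) = cong (_+ 0) (sumℕ-zero k)

sumℕ-vanish : ∀ k {f} → f ≗[ k ] (λ _ → 0) → sumℕ k f ≡ 0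
sumℕ-vanish k f≗0 = trans (sumℕ-cong k f≗0) (sumℕ-zero k)

update : (ℕ → ℕ) → ℕ → ℕ → ℕ → ℕ
update f n v i with i ≟ n
... | yes _ = v
... | no  _ = f i

update-≡ : ∀ f n v → update f n v n ≡ v
update-≡ f n v with n ≟ n
... | yes _   = refl
... | no  n≢n = contradiction refl n≢n

update-≢ : ∀ f {n} v {i} → i ≢ n → update f n v i ≡ f i
update-≢ f {n} v {i} i≢n with i ≟ n
... | yes i≡n = contradiction i≡n i≢n
... | no  _   = refl

update-id : ∀ f n i → update f n (f n) i ≡ f i
update-id f n i with i ≟ n
... | yes refl = refl
... | no  _    = refl

update-below : ∀ f {k} v → update f (suc k) v ≗[ k ] f
update-below f v _ i≤k = update-≢ f v (λ { refl → 1+n≰n i≤k })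

update-cong : ∀ {k f g} v → f ≗[ k ] g → update f (suc k) v ≗[ suc k ] update g (suc k) v
update-cong {k} v f≗g {i} 1≤i i≤1+k with i ≟ suc k
... | yes _     = refl
... | no  i≢1+k = f≗g 1≤i (≤-pred (≤∧≢⇒< i≤1+k i≢1+k))

sumℕ-update : ∀ k f v → sumℕ (suc k) (update f (suc k) v) ≡ sumℕ k f + v
sumℕ-update k f v = cong₂ _+_ (sumℕ-cong k (update-below f v)) (update-≡ f (suc k) v)

δ : ℕ → ℕ → ℕ
δ i₀ = update (λ _ → 0) i₀ 1

sumℕ-*δ : ∀ k (f : ℕ → ℕ) {i₀} → f 0 ≡ 0 → i₀ ≤ k → sumℕ k (λ i → f i * δ i₀ i) ≡ f i₀
sumℕ-*δ zero    f f0≡0 z≤n = sym f0≡0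
sumℕ-*δ (suc k) f {i₀} f0≡0 i₀≤1+k with i₀ ≟ suc k
... | yes refl = cong₂ _+_
  (sumℕ-vanish k λ {i} 1≤i i≤k →
     trans (cong (f i *_) (update-below (λ _ → 0) 1 1≤i i≤k)) (*-zeroʳ (f i)))
  (trans (cong (f (suc k) *_) (update-≡ (λ _ → 0) (suc k) 1)) (*-identityʳ (f (suc k))))
... | no i₀≢1+k = trans
  (cong₂ _+_ (sumℕ-*δ k f f0≡0 (≤-pred (≤∧≢⇒< i₀≤1+k i₀≢1+k)))
             (trans (cong (f (suc k) *_) (update-≢ (λ _ → 0) 1 (i₀≢1+k ∘ sym))) (*-zeroʳ (f (suc k)))))
  (+-identityʳ (f i₀))

sumℕ-δ≤1 : ∀ k i₀ → sumℕ k (δ i₀) ≤ 1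
sumℕ-δ≤1 zero    i₀ = z≤n
sumℕ-δ≤1 (suc k) i₀ with i₀ ≟ suc k
... | yes refl = ≤-reflexive
  (cong₂ _+_ (sumℕ-vanish k (update-below (λ _ → 0) 1)) (update-≡ (λ _ → 0) (suc k) 1))
... | no i₀≢1+k = ≤-trans
  (≤-reflexive (trans (cong (_+_ (sumℕ k (δ i₀))) (update-≢ (λ _ → 0) 1 (i₀≢1+k ∘ sym)))
                      (+-identityʳ _)))
  (sumℕ-δ≤1 k i₀)

-- Deciding membership in F⁽ᵏ⁾

ExtensionalOn : ℕ → ((ℕ → ℕ) → Set) → Set
ExtensionalOn k P = ∀ {m m'} → m ≗[ k ] m' → P m → P m'

-- The last multiplicity is bounded by H, so it is found by a bounded search.
any-sumℕ≤? : ∀ k {P} → ExtensionalOn k P → Decidable P → ∀ H →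
             Dec (∃ λ m → sumℕ k m ≤ H × P m)
any-sumℕ≤? zero ext P? H =
  map′ (λ p → _ , z≤n , p)
       (λ (m , _ , p) → ext (λ 1≤i i≤0 → contradiction (≤-trans 1≤i i≤0) λ ()) p)
       (P? (λ _ → 0))
any-sumℕ≤? (suc k) {P} ext P? H = map′ assemble decompose (anyUpTo? last? (suc H))
  where
  Last : ℕ → Set
  Last v = ∃ λ m → sumℕ k m ≤ H ∸ v × P (update m (suc k) v)

  last? : Decidable Last
  last? v = any-sumℕ≤? k (ext ∘ update-cong v) (P? ∘ λ m → update m (suc k) v) (H ∸ v)

  assemble : (∃ λ v → v < suc H × Last v) → ∃ λ m → sumℕ (suc k) m ≤ H × P m
  assemble (v , v<1+H , m , Σm≤H∸v , p) =
    update m (suc k) v ,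
    subst (_≤ H) (sym (sumℕ-update k m v)) (m≤o∸n⇒m+n≤o (sumℕ k m) (≤-pred v<1+H) Σm≤H∸v) ,
    p

  decompose : (∃ λ m → sumℕ (suc k) m ≤ H × P m) → ∃ λ v → v < suc H × Last v
  decompose (m , Σm≤H , p) =
    m (suc k) , s≤s (≤-trans (m≤n+m (m (suc k)) (sumℕ k m)) Σm≤H) ,
    m , m+n≤o⇒m≤o∸n (sumℕ k m) Σm≤H , ext (λ {i} _ _ → sym (update-id m (suc k) i)) p

signedWeight : (ℕ → ℕ) → ℕ → (ℕ → ℕ) → (ℕ → ℕ) → ℤ
signedWeight γ k m m' = sumℤ k (λ i → + γ i ℤ.* (+ m i ℤ.- + m' i))

signedWeight-cong : ∀ γ k {m₁ m₂ m₁' m₂'} → m₁ ≗[ k ] m₂ → m₁' ≗[ k ] m₂' →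
                    signedWeight γ k m₁ m₁' ≡ signedWeight γ k m₂ m₂'
signedWeight-cong γ k m₁≗m₂ m₁'≗m₂' = sumℤ-cong k λ {i} 1≤i i≤k →
  cong₂ (λ u v → + γ i ℤ.* (+ u ℤ.- + v)) (m₁≗m₂ 1≤i i≤k) (m₁'≗m₂' 1≤i i≤k)

InF_r? : ∀ h γ k r' q → Dec (InF_r h γ k r' q)
InF_r? h γ k r' q =
  map′ (λ (m , Σm≤ , m' , Σm'≤ , q≡) → m , m' , Σm≤ , Σm'≤ , q≡)
       (λ (m , m' , Σm≤ , Σm'≤ , q≡) → m , Σm≤ , m' , Σm'≤ , q≡)
       (any-sumℕ≤? k extᵐ (λ m → any-sumℕ≤? k (extᵐ' m) (λ m' → q ℚ.≟ _) (h ∸ suc r')) h)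
  where
  extᵐ' : ∀ m → ExtensionalOn k (λ m' → q ≡ signedWeight γ k m m' / suc r')
  extᵐ' m {m₁'} {m₂'} m₁'≗m₂' q≡ =
    trans q≡ (cong (_/ suc r') (signedWeight-cong γ k {m} {m} {m₁'} {m₂'} (λ _ _ → refl) m₁'≗m₂'))

  extᵐ : ExtensionalOn k (λ m → ∃ λ m' → sumℕ k m' ≤ h ∸ suc r' × q ≡ signedWeight γ k m m' / suc r')
  extᵐ {m₁} {m₂} m₁≗m₂ (m' , Σm'≤ , q≡) = m' , Σm'≤ ,
    trans q≡ (cong (_/ suc r') (signedWeight-cong γ k {m₁} {m₂} {m'} {m'} m₁≗m₂ (λ _ _ → refl)))

InF? : ∀ h γ k q → Dec (InF h γ k q)
InF? h γ k q = anyUpTo? (λ r' → InF_r? h γ k r' q) h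

-- Multisets of elements of {γ₀, …, γₖ} and their multiplicity vectors

Initial : (ℕ → ℕ) → ℕ → ℕ → Set
Initial γ k y = ∃ λ i → i ≤ k × y ≡ γ i

0∈Initial : ∀ {γ k} → γ 0 ≡ 0 → Initial γ k 0
0∈Initial γ0≡0 = 0 , z≤n , sym γ0≡0

weight : (ℕ → ℕ) → ℕ → (ℕ → ℕ) → ℕ
weight γ k m = sumℕ k (λ i → γ i * m i)

weight-zero : ∀ γ k → weight γ k (λ _ → 0) ≡ 0
weight-zero γ k = sumℕ-vanish k (λ {i} _ _ → *-zeroʳ (γ i))

weight-+ : ∀ γ k m n → weight γ k (λ i → m i + n i) ≡ weight γ k m + weight γ k n
weight-+ γ k m n =
  trans (sumℕ-cong k (λ {i} _ _ → *-distribˡ-+ (γ i) (m i) (n i))) (sumℕ-+ k _ _)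

signedWeight-split : ∀ γ k m m' → signedWeight γ k m m' ≡ + weight γ k m ℤ.- + weight γ k m'
signedWeight-split γ zero    m m' = refl
signedWeight-split γ (suc k) m m' = begin
  signedWeight γ k m m' ℤ.+ + γ (suc k) ℤ.* (+ m (suc k) ℤ.- + m' (suc k))
    ≡⟨ cong (ℤ._+ (+ γ (suc k) ℤ.* (+ m (suc k) ℤ.- + m' (suc k)))) (signedWeight-split γ k m m') ⟩
  (+ weight γ k m ℤ.- + weight γ k m') ℤ.+ + γ (suc k) ℤ.* (+ m (suc k) ℤ.- + m' (suc k))
    ≡⟨ regroup (+ weight γ k m) (+ weight γ k m') (+ γ (suc k)) (+ m (suc k)) (+ m' (suc k)) ⟩
  (+ weight γ k m ℤ.+ + γ (suc k) ℤ.* + m (suc k)) ℤ.- (+ weight γ k m' ℤ.+ + γ (suc k) ℤ.* + m' (suc k))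
    ≡⟨ sym (cong₂ ℤ._-_ (pos-weight-suc m) (pos-weight-suc m')) ⟩
  + weight γ (suc k) m ℤ.- + weight γ (suc k) m' ∎
  where
  open ≡-Reasoning
  regroup : ∀ (a b g x y : ℤ) → (a ℤ.- b) ℤ.+ g ℤ.* (x ℤ.- y) ≡ (a ℤ.+ g ℤ.* x) ℤ.- (b ℤ.+ g ℤ.* y)
  regroup = ℤ-Solver.solve-∀
  pos-weight-suc : ∀ f → + weight γ (suc k) f ≡ + weight γ k f ℤ.+ + γ (suc k) ℤ.* + f (suc k)
  pos-weight-suc f =
    trans (ℤ.pos-+ (weight γ k f) _) (cong (ℤ._+_ (+ weight γ k f)) (ℤ.pos-* (γ (suc k)) (f (suc k))))

-- Entries with index 0 are not counted: the sums defining F start at γ₁.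
multiplicity : ∀ {γ k xs} → All (Initial γ k) xs → ℕ → ℕ
multiplicity []               i = 0
multiplicity ((i₀ , _) ∷ ps) i = δ i₀ i + multiplicity ps i

weight-multiplicity : ∀ {γ k xs} → γ 0 ≡ 0 → (ps : All (Initial γ k) xs) →
                      weight γ k (multiplicity ps) ≡ sum xs
weight-multiplicity {γ} {k} γ0≡0 [] = weight-zero γ k
weight-multiplicity {γ} {k} γ0≡0 ((i₀ , i₀≤k , refl) ∷ ps) =
  trans (weight-+ γ k (δ i₀) (multiplicity ps))
        (cong₂ _+_ (sumℕ-*δ k γ {i₀} γ0≡0 i₀≤k) (weight-multiplicity {γ} {k} γ0≡0 ps))

sumℕ-multiplicity≤ : ∀ {γ k xs} (ps : All (Initial γ k) xs) → sumℕ k (multiplicity ps) ≤ length xs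
sumℕ-multiplicity≤ {k = k} []               = ≤-reflexive (sumℕ-zero k)
sumℕ-multiplicity≤ {k = k} ((i₀ , _) ∷ ps) =
  ≤-trans (≤-reflexive (sumℕ-+ k (δ i₀) (multiplicity ps)))
          (+-mono-≤ (sumℕ-δ≤1 k i₀) (sumℕ-multiplicity≤ ps))

sum-replicate : ∀ n x → sum (replicate n x) ≡ n * x
sum-replicate zero    x = refl
sum-replicate (suc n) x = cong (_+_ x) (sum-replicate n x)

sum-replicate-++ : ∀ c x ys → sum (replicate c x ++ ys) ≡ c * x + sum ys
sum-replicate-++ c x ys = trans (sum-++ (replicate c x) ys) (cong (_+ sum ys) (sum-replicate c x))

length-replicate-++ : ∀ c (x : ℕ) ys → length (replicate c x ++ ys) ≡ c + length ys
length-replicate-++ c x ys = trans (length-++ (replicate c x)) (cong (_+ length ys) (length-replicate c))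

expand : (ℕ → ℕ) → ℕ → (ℕ → ℕ) → List ℕ
expand γ zero    m = []
expand γ (suc k) m = expand γ k m ++ replicate (m (suc k)) (γ (suc k))

sum-expand : ∀ γ k m → sum (expand γ k m) ≡ weight γ k m
sum-expand γ zero    m = refl
sum-expand γ (suc k) m = trans (sum-++ (expand γ k m) _)
  (cong₂ _+_ (sum-expand γ k m) (trans (sum-replicate (m (suc k)) _) (*-comm (m (suc k)) _)))

length-expand : ∀ γ k m → length (expand γ k m) ≡ sumℕ k m
length-expand γ zero    m = refl
length-expand γ (suc k) m = trans (length-++ (expand γ k m))
  (cong₂ _+_ (length-expand γ k m) (length-replicate (m (suc k))))

expand-Initial : ∀ γ k m → All (Initial γ k) (expand γ k m)
expand-Initial γ zero    m = []
expand-Initial γ (suc k) m =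
  ++⁺ (All.map (λ (i , i≤k , e) → i , m≤n⇒m≤1+n i≤k , e) (expand-Initial γ k m))
      (replicate⁺ (m (suc k)) (suc k , ≤-refl , refl))

-- Bₕ-sets, read on lists

IsBh-⊆ : ∀ {h} {A B : ℕ → Set} → (∀ {y} → A y → B y) → IsBh h B → IsBh h A
IsBh-⊆ A⊆B bh a b pa pb = bh a b (VecAll.map A⊆B pa) (VecAll.map A⊆B pb)

sum-toList : ∀ {n} (v : Vec ℕ n) → Vec.sum v ≡ sum (toList v)
sum-toList Vec.[]       = refl
sum-toList (x Vec.∷ v) = cong (_+_ x) (sum-toList v)

toVec : ∀ {n} (xs : List ℕ) → length xs ≡ n → ∃ λ (v : Vec ℕ n) → toList v ≡ xs
toVec xs refl = fromList xs , toList∘fromList xs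

IsBh⇒↭ : ∀ {h A} → IsBh h A → ∀ {xs ys} → All A xs → All A ys →
         length xs ≡ h → length ys ≡ h → sum xs ≡ sum ys → xs ↭ ys
IsBh⇒↭ bh {xs} {ys} pxs pys lxs lys Σ≡ with toVec xs lxs | toVec ys lys
... | u , refl | v , refl =
  bh u v (toList⁻ pxs) (toList⁻ pys) (trans (sum-toList u) (trans Σ≡ (sym (sum-toList v))))

padZeros : ℕ → List ℕ → List ℕ
padZeros h xs = replicate (h ∸ length xs) 0 ++ xs

IsBh⇒padZeros-↭ : ∀ {h A} → IsBh h A → A 0 → ∀ {xs ys} → All A xs → All A ys →
                  length xs ≤ h → length ys ≤ h → sum xs ≡ sum ys → padZeros h xs ↭ padZeros h ys
IsBh⇒padZeros-↭ {h} {A} bh A0 {xs} {ys} pxs pys lxs≤h lys≤h Σ≡ =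
  IsBh⇒↭ bh (padded {xs} pxs) (padded {ys} pys)
    (length-padded {xs} lxs≤h) (length-padded {ys} lys≤h)
    (trans (sum-padded xs) (trans Σ≡ (sym (sum-padded ys))))
  where
  padded : ∀ {zs} → All A zs → All A (padZeros h zs)
  padded pzs = ++⁺ (replicate⁺ _ A0) pzs
  length-padded : ∀ {zs} → length zs ≤ h → length (padZeros h zs) ≡ h
  length-padded {zs} lzs≤h = trans (length-replicate-++ (h ∸ length zs) 0 zs) (m∸n+n≡m lzs≤h)
  sum-padded : ∀ zs → sum (padZeros h zs) ≡ sum zs
  sum-padded zs =
    trans (sum-replicate-++ (h ∸ length zs) 0 zs) (cong (_+ sum zs) (*-zeroʳ (h ∸ length zs)))

++-cancelˡ-↭ : ∀ (zs : List ℕ) {xs ys} → zs ++ xs ↭ zs ++ ys → xs ↭ ys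
++-cancelˡ-↭ []       p = p
++-cancelˡ-↭ (z ∷ zs) p = ++-cancelˡ-↭ zs (drop-∷ p)

IsBh⇒↭-shorter : ∀ {h A} → IsBh h A → A 0 → ∀ {xs ys} → All A xs → All A ys →
                 length xs ≡ length ys → length xs ≤ h → sum xs ≡ sum ys → xs ↭ ys
IsBh⇒↭-shorter {h} bh A0 {xs} {ys} pxs pys lxs≡lys lxs≤h Σ≡ =
  ++-cancelˡ-↭ (replicate (h ∸ length xs) 0)
    (subst (λ l → padZeros h xs ↭ replicate (h ∸ l) 0 ++ ys) (sym lxs≡lys)
      (IsBh⇒padZeros-↭ bh A0 pxs pys lxs≤h (subst (_≤ h) lxs≡lys lxs≤h) Σ≡))

separate : ∀ {A : ℕ → Set} j {xs} → All (λ y → A y ⊎ y ≡ j) xs →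
           ∃₂ λ c ys → All A ys × xs ↭ replicate c j ++ ys
separate j []                = 0 , [] , [] , ↭-refl
separate j (inj₁ a ∷ ps) with separate j ps
... | c , ys , qs , π = c , _ ∷ ys , a ∷ qs , ↭-trans (prep _ π) (↭-sym (shift _ (replicate c j) ys))
separate j (inj₂ refl ∷ ps) with separate j ps
... | c , ys , qs , π = suc c , ys , qs , prep j π

n/1≡z/[1+d]⇒z≡[1+d]*n : ∀ n z d → + n / 1 ≡ z / suc d → z ≡ + (suc d * n)
n/1≡z/[1+d]⇒z≡[1+d]*n n z d eq with fromℚᵘ-injective {mkℚᵘ (+ n) 0} {mkℚᵘ z d} eq
... | *≡* n*[1+d]≡z*1 = begin
  z                 ≡⟨ sym (ℤ.*-identityʳ z) ⟩
  z ℤ.* + 1         ≡⟨ sym n*[1+d]≡z*1 ⟩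
  + n ℤ.* + suc d   ≡⟨ sym (ℤ.pos-* n (suc d)) ⟩
  + (n * suc d)     ≡⟨ cong +_ (*-comm n (suc d)) ⟩
  + (suc d * n)     ∎
  where open ≡-Reasoning

n/1≡[[1+d]*n]/[1+d] : ∀ n d → + n / 1 ≡ + (suc d * n) / suc d
n/1≡[[1+d]*n]/[1+d] n d = fromℚᵘ-cong {mkℚᵘ (+ n) 0} {mkℚᵘ (+ (suc d * n)) d} (*≡* (begin
  + n ℤ.* + suc d       ≡⟨ sym (ℤ.pos-* n (suc d)) ⟩
  + (n * suc d)         ≡⟨ cong +_ (*-comm n (suc d)) ⟩
  + (suc d * n)         ≡⟨ sym (ℤ.*-identityʳ _) ⟩
  + (suc d * n) ℤ.* + 1 ∎))
  where open ≡-Reasoning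

InF-intro : ∀ {h γ k} → γ 0 ≡ 0 → ∀ r' j {as bs} → All (Initial γ k) as → All (Initial γ k) bs →
            suc r' * j + sum as ≡ sum bs → suc r' + length as ≤ h → length bs ≤ h →
            InF h γ k (+ j / 1)
InF-intro {h} {γ} {k} γ0≡0 r' j {as} {bs} pas pbs Σ≡ r+las≤h lbs≤h =
  r' , ≤-trans (m≤m+n (suc r') (length as)) r+las≤h ,
  multiplicity pbs , multiplicity pas ,
  ≤-trans (sumℕ-multiplicity≤ pbs) lbs≤h ,
  ≤-trans (sumℕ-multiplicity≤ pas)
          (m+n≤o⇒m≤o∸n (length as) (subst (_≤ h) (+-comm (suc r') (length as)) r+las≤h)) ,
  trans (n/1≡[[1+d]*n]/[1+d] j r') (cong (_/ suc r') (sym value))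
  where
  open ≡-Reasoning
  cancel : ∀ (a b : ℤ) → (a ℤ.+ b) ℤ.- b ≡ a
  cancel = ℤ-Solver.solve-∀
  value : signedWeight γ k (multiplicity pbs) (multiplicity pas) ≡ + (suc r' * j)
  value = begin
    signedWeight γ k (multiplicity pbs) (multiplicity pas)
      ≡⟨ signedWeight-split γ k _ _ ⟩
    + weight γ k (multiplicity pbs) ℤ.- + weight γ k (multiplicity pas)
      ≡⟨ cong₂ (λ u v → + u ℤ.- + v) (weight-multiplicity γ0≡0 pbs) (weight-multiplicity γ0≡0 pas) ⟩
    + sum bs ℤ.- + sum as
      ≡⟨ cong (λ u → + u ℤ.- + sum as) (sym Σ≡) ⟩
    + (suc r' * j + sum as) ℤ.- + sum as
      ≡⟨ cong (ℤ._- + sum as) (ℤ.pos-+ (suc r' * j) (sum as)) ⟩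
    (+ (suc r' * j) ℤ.+ + sum as) ℤ.- + sum as
      ≡⟨ cancel (+ (suc r' * j)) (+ sum as) ⟩
    + (suc r' * j) ∎

InF-elim : ∀ {h γ k r' x} → InF_r h γ k r' (+ x / 1) →
           ∃₂ λ m m' → sumℕ k m ≤ h × sumℕ k m' ≤ h ∸ suc r' ×
                       weight γ k m ≡ suc r' * x + weight γ k m'
InF-elim {h} {γ} {k} {r'} {x} (m , m' , Σm≤h , Σm'≤ , q≡) =
  m , m' , Σm≤h , Σm'≤ , ℤ.+-injective (begin
    + weight γ k m
      ≡⟨ uncancel (+ weight γ k m) (+ weight γ k m') ⟩
    (+ weight γ k m ℤ.- + weight γ k m') ℤ.+ + weight γ k m'
      ≡⟨ cong (ℤ._+ _) difference ⟩
    + (suc r' * x) ℤ.+ + weight γ k m'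
      ≡⟨ sym (ℤ.pos-+ (suc r' * x) _) ⟩
    + (suc r' * x + weight γ k m') ∎)
  where
  open ≡-Reasoning
  uncancel : ∀ (a b : ℤ) → a ≡ (a ℤ.- b) ℤ.+ b
  uncancel = ℤ-Solver.solve-∀
  difference : + weight γ k m ℤ.- + weight γ k m' ≡ + (suc r' * x)
  difference = trans (sym (signedWeight-split γ k m m')) (n/1≡z/[1+d]⇒z≡[1+d]*n x _ r' q≡)

InF-suc : ∀ {h γ k q} → InF h γ k q → InF h γ (suc k) q
InF-suc {h} {γ} {k} (r' , r'<h , m , m' , Σm≤ , Σm'≤ , q≡) =
  r' , r'<h , update m (suc k) 0 , update m' (suc k) 0 ,
  subst (_≤ h) (sym (sumℕ-update₀ m)) Σm≤ , subst (_≤ h ∸ suc r') (sym (sumℕ-update₀ m')) Σm'≤ ,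
  trans q≡ (cong (_/ suc r') (sym unchanged))
  where
  sumℕ-update₀ : ∀ f → sumℕ (suc k) (update f (suc k) 0) ≡ sumℕ k f
  sumℕ-update₀ f = trans (sumℕ-update k f 0) (+-identityʳ _)
  unchanged : signedWeight γ (suc k) (update m (suc k) 0) (update m' (suc k) 0) ≡ signedWeight γ k m m'
  unchanged = trans
    (cong₂ ℤ._+_ (signedWeight-cong γ k (update-below m 0) (update-below m' 0))
      (trans (cong₂ (λ u v → + γ (suc k) ℤ.* (+ u ℤ.- + v))
                    (update-≡ m (suc k) 0) (update-≡ m' (suc k) 0))
             (ℤ.*-zeroʳ (+ γ (suc k)))))
    (ℤ.+-identityʳ _)

cancel-multiple : ∀ c d j a b → c * j + b ≡ suc (c + d) * j + a → suc d * j + a ≡ b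
cancel-multiple c d j a b eq = +-cancelˡ-≡ (c * j) _ _ (trans (regroup c d j a) (sym eq))
  where
  regroup : ∀ c d j a → c * j + (suc d * j + a) ≡ suc (c + d) * j + a
  regroup = ℕ-Solver.solve-∀

InF-from-excess : ∀ {h γ k} → γ 0 ≡ 0 → ∀ {c₁ c₂ j as bs} →
                  All (Initial γ k) as → All (Initial γ k) bs → c₁ < c₂ →
                  c₁ * j + sum bs ≡ c₂ * j + sum as → c₂ + length as ≡ h → length bs ≤ h →
                  InF h γ k (+ j / 1)
InF-from-excess {h} γ0≡0 {c₁} {j = j} {as} {bs} pas pbs c₁<c₂ Σ≡ c₂+las≡h lbs≤h
  with m≤n⇒∃[o]m+o≡n c₁<c₂
... | d , refl =
  InF-intro γ0≡0 d j pas pbs (cancel-multiple c₁ d j (sum as) (sum bs) Σ≡)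
    (≤-trans (+-monoˡ-≤ (length as) (s≤s (m≤n+m d c₁))) (≤-reflexive c₂+las≡h)) lbs≤h

Extend-IsBh : ∀ {h γ k j} → γ 0 ≡ 0 → IsBh h (Initial γ k) → ¬ InF h γ k (+ j / 1) →
              IsBh h (Extend γ k j)
Extend-IsBh {h} {γ} {k} {j} γ0≡0 bh j∉F a b pa pb Σ≡
  with separate j (toList⁺ pa) | separate j (toList⁺ pb)
... | cA , A' , pA' , πA | cB , B' , pB' , πB =
  ↭-trans πA (↭-trans (compare (<-cmp cA cB)) (↭-sym πB))
  where
  open ≡-Reasoning
  sums : cA * j + sum A' ≡ cB * j + sum B'
  sums = begin
    cA * j + sum A'              ≡⟨ sym (sum-replicate-++ cA j A') ⟩
    sum (replicate cA j ++ A')   ≡⟨ sym (sum-↭ πA) ⟩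
    sum (toList a)               ≡⟨ sym (sum-toList a) ⟩
    Vec.sum a                    ≡⟨ Σ≡ ⟩
    Vec.sum b                    ≡⟨ sum-toList b ⟩
    sum (toList b)               ≡⟨ sum-↭ πB ⟩
    sum (replicate cB j ++ B')   ≡⟨ sum-replicate-++ cB j B' ⟩
    cB * j + sum B'              ∎
  lengthA : cA + length A' ≡ h
  lengthA = trans (sym (length-replicate-++ cA j A')) (trans (sym (↭-length πA)) (length-toList a))
  lengthB : cB + length B' ≡ h
  lengthB = trans (sym (length-replicate-++ cB j B')) (trans (sym (↭-length πB)) (length-toList b))
  A'≤h : length A' ≤ h
  A'≤h = m+n≤o⇒n≤o cA (≤-reflexive lengthA)
  B'≤h : length B' ≤ h
  B'≤h = m+n≤o⇒n≤o cB (≤-reflexive lengthB)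
  compare : Tri (cA < cB) (cA ≡ cB) (cB < cA) → replicate cA j ++ A' ↭ replicate cB j ++ B'
  compare (tri< cA<cB _ _) = ⊥-elim (j∉F (InF-from-excess γ0≡0 pB' pA' cA<cB sums lengthB A'≤h))
  compare (tri> _ _ cB<cA) = ⊥-elim (j∉F (InF-from-excess γ0≡0 pA' pB' cB<cA (sym sums) lengthA B'≤h))
  compare (tri≈ _ refl _) = ++⁺ˡ (replicate cA j)
    (IsBh⇒↭-shorter bh (0∈Initial γ0≡0) pA' pB'
      (+-cancelˡ-≡ cA _ _ (trans lengthA (sym lengthB))) A'≤h (+-cancelˡ-≡ (cA * j) _ _ sums))

-- The greedy Bₕ-set

module _ {h γ} (greedy : IsGreedyBh h γ) where

  private
    γ0≡0 : γ 0 ≡ 0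
    γ0≡0 = proj₁ greedy

    γ-< : ∀ k → γ k < γ (suc k)
    γ-< k = proj₁ (proj₂ greedy k)

    step-IsBh : ∀ k → IsBh h (Extend γ k (γ (suc k)))
    step-IsBh k = proj₁ (proj₂ (proj₂ greedy k))

    gap-¬IsBh : ∀ k x → γ k < x → x < γ (suc k) → ¬ IsBh h (Extend γ k x)
    gap-¬IsBh k = proj₂ (proj₂ (proj₂ greedy k))

  γ-mono : ∀ {i j} → i < j → γ i < γ j
  γ-mono {i} {suc j} (s≤s i≤j) with m≤n⇒m<n∨m≡n i≤j
  ... | inj₁ i<j  = <-trans (γ-mono i<j) (γ-< j)
  ... | inj₂ refl = γ-< i

  γ-suc∉Initial : ∀ k → ¬ Initial γ k (γ (suc k))
  γ-suc∉Initial k (i , i≤k , γ₁₊ₖ≡γᵢ) = <⇒≢ (γ-mono (s≤s i≤k)) (sym γ₁₊ₖ≡γᵢ)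

  Initial-IsBh : ∀ k → IsBh h (Initial γ k)
  Initial-IsBh zero a b pa pb _ = ↭-reflexive (cong toList (all-zero pa pb))
    where
    all-zero : ∀ {n} {u v : Vec ℕ n} → VecAll.All (Initial γ 0) u → VecAll.All (Initial γ 0) v → u ≡ v
    all-zero VecAll.[] VecAll.[] = refl
    all-zero ((0 , z≤n , refl) VecAll.∷ pu) ((0 , z≤n , refl) VecAll.∷ pv) =
      cong (_ Vec.∷_) (all-zero pu pv)
  Initial-IsBh (suc k) = IsBh-⊆ lower (step-IsBh k)
    where
    lower : ∀ {y} → Initial γ (suc k) y → Extend γ k (γ (suc k)) y
    lower (i , i≤1+k , y≡γᵢ) with m≤n⇒m<n∨m≡n i≤1+k
    ... | inj₁ i<1+k = inj₁ (i , ≤-pred i<1+k , y≡γᵢ)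
    ... | inj₂ refl  = inj₂ y≡γᵢ

  γ-suc∉F : ∀ k → ¬ InF h γ k (+ γ (suc k) / 1)
  γ-suc∉F k (r' , r'<h , q∈F_r) with InF-elim {h} {γ} {k} q∈F_r
  ... | m , m' , Σm≤h , Σm'≤ , balance =
    γ-suc∉Initial k (All.lookup padded-Y-Initial (∈-resp-↭ π x∈padded-X))
    where
    x = γ (suc k)
    X = replicate (suc r') x ++ expand γ k m'
    Y = expand γ k m

    X≤h : length X ≤ h
    X≤h = begin
      length X                        ≡⟨ length-replicate-++ (suc r') x _ ⟩
      suc r' + length (expand γ k m') ≡⟨ cong (_+_ (suc r')) (length-expand γ k m') ⟩
      suc r' + sumℕ k m'              ≤⟨ +-monoʳ-≤ (suc r') Σm'≤ ⟩
      suc r' + (h ∸ suc r')           ≡⟨ m+[n∸m]≡n r'<h ⟩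
      h                               ∎
      where open ≤-Reasoning

    ΣX≡ΣY : sum X ≡ sum Y
    ΣX≡ΣY = begin
      sum X                            ≡⟨ sum-replicate-++ (suc r') x _ ⟩
      suc r' * x + sum (expand γ k m') ≡⟨ cong (_+_ (suc r' * x)) (sum-expand γ k m') ⟩
      suc r' * x + weight γ k m'       ≡⟨ sym balance ⟩
      weight γ k m                     ≡⟨ sym (sum-expand γ k m) ⟩
      sum Y                            ∎
      where open ≡-Reasoning

    π : padZeros h X ↭ padZeros h Y
    π = IsBh⇒padZeros-↭ (step-IsBh k) (inj₁ (0∈Initial γ0≡0))
      (++⁺ (replicate⁺ (suc r') (inj₂ refl)) (All.map inj₁ (expand-Initial γ k m')))
      (All.map inj₁ (expand-Initial γ k m))
      X≤h (subst (_≤ h) (sym (length-expand γ k m)) Σm≤h) ΣX≡ΣY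

    x∈padded-X : x ∈ padZeros h X
    x∈padded-X = ∈-++⁺ʳ (replicate _ 0) (here refl)

    padded-Y-Initial : All (Initial γ k) (padZeros h Y)
    padded-Y-Initial = ++⁺ (replicate⁺ _ (0∈Initial γ0≡0)) (expand-Initial γ k m)

  <γ-suc⇒∈F : 1 ≤ h → ∀ k {j} → j < γ (suc k) → InF h γ k (+ j / 1)
  <γ-suc⇒∈F 1≤h k {j} j<γ₁₊ₖ with <-cmp j (γ k)
  <γ-suc⇒∈F 1≤h zero    {j} j<γ₁ | tri< j<γ₀ _ _ = contradiction (subst (j <_) γ0≡0 j<γ₀) n≮0
  <γ-suc⇒∈F 1≤h (suc k) j<γ₂₊ₖ    | tri< j<γ₁₊ₖ _ _ = InF-suc {h} {γ} {k} (<γ-suc⇒∈F 1≤h k j<γ₁₊ₖ)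
  <γ-suc⇒∈F 1≤h k j<γ₁₊ₖ | tri≈ _ refl _ =
    InF-intro {h} {γ} {k} γ0≡0 0 (γ k) [] ((k , ≤-refl , refl) ∷ []) (+-identityʳ _) 1≤h 1≤h
  <γ-suc⇒∈F 1≤h k {j} j<γ₁₊ₖ | tri> _ _ γₖ<j = decidable-stable (InF? h γ k (+ j / 1))
    λ j∉F → gap-¬IsBh k j γₖ<j j<γ₁₊ₖ (Extend-IsBh γ0≡0 (Initial-IsBh k) j∉F)

lemma7 : (h : ℕ) → 1 ≤ h → (γ : ℕ → ℕ) → IsGreedyBh h γ →
    (k : ℕ) → IsMex (InF h γ k) (γ (suc k))
lemma7 h 1≤h γ greedy k = γ-suc∉F greedy k , λ j → <γ-suc⇒∈F greedy 1≤h k
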